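{- For every connected graph $G$ and any graph $H$, $$\xi(G\odot H)\le \xi(G)\,\mathrm{n}(H)+\mathrm{n}(G).$$
   Context: All graphs are finite, simple and undirected; $\mathrm{n}(H)$ denotes the order of $H$. For a connected graph $\Gamma$, a set $S\subseteq V(\Gamma)$ is a distance-equalizer set if for every two distinct $u,v\in V(\Gamma)\setminus S$ there is $w\in S$ with $d_\Gamma(w,u)=d_\Gamma(w,v)$; $\xi(\Gamma)$ is the minimum cardinality of such a set. For $V(G)=\{v_1,\dots,v_n\}$, the corona product $G\odot H$ is obtained from $G$ and $n$ pairwise disjoint copies $H_1,\dots,H_n$ of $H$ by joining $v_i$ to every vertex of $H_i$. -}

module Defs where

open import Data.Nat using (ℕ; zero; suc; _+_; _*_; _≤_)
open import Data.Fin using (Fin; splitAt; remQuot; _≟_)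
open import Data.Fin.Subset using (Subset; _∈_; _∉_; ∣_∣)
open import Data.Bool using (Bool; true; false; _∧_)
open import Data.Sum using (_⊎_; inj₁; inj₂)
import Data.Sum as Sum
open import Data.Empty using (⊥-elim)
open import Data.Product using (Σ; _×_; _,_; ∃; ∃-syntax)
open import Relation.Nullary using (¬_; yes; no)
open import Relation.Nullary.Decidable using (⌊_⌋)
open import Relation.Binary.PropositionalEquality using (_≡_; refl; cong₂)
import Relation.Binary.PropositionalEquality as ≡

record Graph : Set where
  field
    n     : ℕ
    adj   : Fin n → Fin n → Bool
    sym   : ∀ u v → adj u v ≡ adj v u
    loopless : ∀ u → adj u u ≡ false
open Graph public

order : Graph → ℕ
order G = n G

data Walk (G : Graph) : Fin (n G) → Fin (n G) → ℕ → Set where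
  here : ∀ {u} → Walk G u u zero
  step : ∀ {u v w k} → adj G u v ≡ true → Walk G v w k → Walk G u w (suc k)

Dist : (G : Graph) → Fin (n G) → Fin (n G) → ℕ → Set
Dist G u v k = Walk G u v k × (∀ m → Walk G u v m → k ≤ m)

Connected : Graph → Set
Connected G = ∀ u v → ∃[ k ] Walk G u v k

IsDistanceEqualizer : (G : Graph) → Subset (n G) → Set
IsDistanceEqualizer G S =
  ∀ u v → ¬ (u ≡ v) → u ∉ S → v ∉ S →
  ∃[ w ] (w ∈ S × ∃[ k ] (Dist G w u k × Dist G w v k))

IsXi : Graph → ℕ → Set
IsXi G k =
  (∃[ S ] (IsDistanceEqualizer G S × ∣ S ∣ ≡ k)) ×
  (∀ S → IsDistanceEqualizer G S → k ≤ ∣ S ∣)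

-- Vertex set Fin (n G + n G * n H):
-- the first n G vertices (decoded by splitAt as inj₁ i) are v_i of G; a vertex
-- of the second block, decoded by remQuot as inj₂ (i , a), is vertex a of the
-- copy H_i attached to v_i.
eqᵇ : ∀ {m} → Fin m → Fin m → Bool
eqᵇ i j = ⌊ i ≟ j ⌋

eqᵇ-sym : ∀ {m} (i j : Fin m) → eqᵇ i j ≡ eqᵇ j i
eqᵇ-sym i j with i ≟ j | j ≟ i
... | yes _ | yes _ = refl
... | no _ | no _ = refl
... | yes p | no q = ⊥-elim (q (≡.sym p))
... | no p | yes q = ⊥-elim (p (≡.sym q))

eqᵇ-refl : ∀ {m} (i : Fin m) → eqᵇ i i ≡ true
eqᵇ-refl i with i ≟ i
... | yes _ = refl
... | no p = ⊥-elim (p refl)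

CVertex : Graph → Graph → Set
CVertex G H = Fin (n G) ⊎ (Fin (n G) × Fin (n H))

cAdj : (G H : Graph) → CVertex G H → CVertex G H → Bool
cAdj G H (inj₁ i) (inj₁ j) = adj G i j
cAdj G H (inj₁ i) (inj₂ (j , b)) = eqᵇ i j
cAdj G H (inj₂ (i , a)) (inj₁ j) = eqᵇ i j
cAdj G H (inj₂ (i , a)) (inj₂ (j , b)) = eqᵇ i j ∧ adj H a b

cAdj-sym : (G H : Graph) → ∀ x y → cAdj G H x y ≡ cAdj G H y x
cAdj-sym G H (inj₁ i) (inj₁ j) = sym G i j
cAdj-sym G H (inj₁ i) (inj₂ (j , b)) = eqᵇ-sym i j
cAdj-sym G H (inj₂ (i , a)) (inj₁ j) = eqᵇ-sym i j
cAdj-sym G H (inj₂ (i , a)) (inj₂ (j , b)) = cong₂ _∧_ (eqᵇ-sym i j) (sym H a b)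

cAdj-loopless : (G H : Graph) → ∀ x → cAdj G H x x ≡ false
cAdj-loopless G H (inj₁ i) = loopless G i
cAdj-loopless G H (inj₂ (i , a)) = cong₂ _∧_ (eqᵇ-refl i) (loopless H a)

decode : (G H : Graph) → Fin (n G + n G * n H) → CVertex G H
decode G H x = Sum.map₂ (remQuot {n G} (n H)) (splitAt (n G) x)

corona : Graph → Graph → Graph
corona G H = record
  { n = n G + n G * n H
  ; adj = λ x y → cAdj G H (decode G H x) (decode G H y)
  ; sym = λ x y → cAdj-sym G H (decode G H x) (decode G H y)
  ; loopless = λ x → cAdj-loopless G H (decode G H x)
  }

{-# OPTIONS --safe #-}
module Submission where

-- Given a distance-equalizer set S of G, take every vertex v_i of G together with the
-- whole copy H_i for each i ∈ S; this has |S| n(H) + n(G) vertices. Two vertices outside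
-- it lie in copies H_i, H_j with i, j ∉ S. If i = j, then v_i is at distance 1 from both.
-- Otherwise some w ∈ S has d_G(w, i) = d_G(w, j), and since every walk from v_w into H_i
-- passes through v_i, d(v_w, x) = d_G(w, i) + 1 for each x in H_i; so v_w equalizes them.

open import Defs
open import Data.Nat using (ℕ; suc; _+_; _*_; _≤_; z≤n; s≤s)
open import Data.Nat.Properties using (≤-refl; ≤-trans; ≤-reflexive; +-suc; +-comm; m≤n+m; m≤n⇒m≤1+n)
open import Data.Fin using (Fin; _↑ˡ_; splitAt; remQuot; combine; _≟_)
open import Data.Fin.Properties using (splitAt-↑ˡ; combine-remQuot)
open import Data.Fin.Subset using (Subset; inside; outside; ⊤; _∈_; _∉_; ∣_∣)
open import Data.Fin.Subset.Properties using (∣⊤∣≡n; ∣⊥∣≡0)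
open import Data.Vec using ([]; _∷_; _++_; concat; map; replicate; lookup)
open import Data.Vec.Properties using (lookup-splitAt; lookup-concat; lookup-map; lookup-replicate; lookup⇒[]=; []=⇒lookup)
open import Data.Bool using (Bool; true)
open import Data.Bool.Properties using (∧-conicalˡ)
open import Data.Sum using (inj₁; inj₂; [_,_]′)
import Data.Sum as Sum
open import Data.Product using (_×_; _,_; ∃-syntax; proj₁; proj₂)
open import Data.Empty using (⊥-elim)
open import Relation.Nullary using (yes; no)
open import Relation.Binary.PropositionalEquality using (_≡_; refl; trans; cong; cong₂; subst; module ≡-Reasoning)
import Relation.Binary.PropositionalEquality as ≡

∣p++q∣≡∣p∣+∣q∣ : ∀ {m k} (p : Subset m) (q : Subset k) → ∣ p ++ q ∣ ≡ ∣ p ∣ + ∣ q ∣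
∣p++q∣≡∣p∣+∣q∣ []            q = refl
∣p++q∣≡∣p∣+∣q∣ (outside ∷ p) q = ∣p++q∣≡∣p∣+∣q∣ p q
∣p++q∣≡∣p∣+∣q∣ (inside  ∷ p) q = cong suc (∣p++q∣≡∣p∣+∣q∣ p q)

inflate : ∀ {m} k → Subset m → Subset (m * k)
inflate k p = concat (map (replicate k) p)

∣inflate∣ : ∀ {m} k (p : Subset m) → ∣ inflate k p ∣ ≡ ∣ p ∣ * k
∣inflate∣ k []            = refl
∣inflate∣ k (outside ∷ p) =
  trans (∣p++q∣≡∣p∣+∣q∣ (replicate k outside) _) (cong₂ _+_ (∣⊥∣≡0 k) (∣inflate∣ k p))
∣inflate∣ k (inside ∷ p)  =
  trans (∣p++q∣≡∣p∣+∣q∣ (replicate k inside) _) (cong₂ _+_ (∣⊤∣≡n k) (∣inflate∣ k p))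

lookup-inflate : ∀ {m} k (p : Subset m) j → lookup (inflate k p) j ≡ lookup p (proj₁ (remQuot {m} k j))
lookup-inflate {m} k p j = begin
  lookup (inflate k p) j                    ≡⟨ cong (lookup (inflate k p)) (≡.sym (combine-remQuot {m} k j)) ⟩
  lookup (inflate k p) (combine i a)        ≡⟨ lookup-concat (map (replicate k) p) i a ⟩
  lookup (lookup (map (replicate k) p) i) a ≡⟨ cong (λ block → lookup block a) (lookup-map i (replicate k) p) ⟩
  lookup (replicate k (lookup p i)) a       ≡⟨ lookup-replicate a (lookup p i) ⟩
  lookup p i                                ∎
  where
  open ≡-Reasoning
  i = proj₁ (remQuot {m} k j)
  a = proj₂ (remQuot {m} k j)

eqᵇ⇒≡ : ∀ {m} {i j : Fin m} → eqᵇ i j ≡ true → i ≡ j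
eqᵇ⇒≡ {i = i} {j} e with i ≟ j
... | yes i≡j = i≡j
eqᵇ⇒≡ () | no _

Walk-snoc : ∀ {G u v w k} → Walk G u v k → adj G v w ≡ true → Walk G u w (suc k)
Walk-snoc here         e = step e here
Walk-snoc (step e′ p) e = step e′ (Walk-snoc p e)

Walk-map : ∀ {G G′} (f : Fin (n G) → Fin (n G′)) →
           (∀ {u v} → adj G u v ≡ true → adj G′ (f u) (f v) ≡ true) →
           ∀ {u v k} → Walk G u v k → Walk G′ (f u) (f v) k
Walk-map f hom here       = here
Walk-map f hom (step e p) = step (hom e) (Walk-map f hom p)

Dist-refl : ∀ {G} u → Dist G u u 0
Dist-refl u = here , λ _ _ → z≤n

module Corona (G H : Graph) where

  ι : Fin (n G) → Fin (n (corona G H))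
  ι u = u ↑ˡ (n G * n H)

  decode-ι : ∀ u → decode G H (ι u) ≡ inj₁ u
  decode-ι u = cong (Sum.map₂ (remQuot {n G} (n H))) (splitAt-↑ˡ (n G) u (n G * n H))

  adj-ι : ∀ {u v} → adj G u v ≡ true → adj (corona G H) (ι u) (ι v) ≡ true
  adj-ι {u} {v} e rewrite decode-ι u | decode-ι v = e

  adj-ι-copy : ∀ {i a x} → decode G H x ≡ inj₂ (i , a) → adj (corona G H) (ι i) x ≡ true
  adj-ι-copy {i} dx rewrite decode-ι i | dx = eqᵇ-refl i

  base : CVertex G H → Fin (n G)
  base (inj₁ i)       = i
  base (inj₂ (i , _)) = i

  depth : CVertex G H → ℕ
  depth (inj₁ _) = 0
  depth (inj₂ _) = 1

  -- Walking one corona edge moves the base along at most one edge of G, and only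
  -- when both ends lie in G; the depth term accounts for entering or leaving a copy.
  base-step : ∀ p q {t k m d} → cAdj G H p q ≡ true → Walk G (base q) t k →
              d + k ≤ depth q + m → ∃[ k′ ] (Walk G (base p) t k′ × d + k′ ≤ depth p + suc m)
  base-step (inj₁ i) (inj₁ j) {k = k} {d = d} e w le =
    suc k , step e w , ≤-trans (≤-reflexive (+-suc d k)) (s≤s le)
  base-step (inj₁ i) (inj₂ (j , b)) e w le with refl ← eqᵇ⇒≡ e = _ , w , le
  base-step (inj₂ (i , a)) (inj₁ j) {m = m} e w le with refl ← eqᵇ⇒≡ e = _ , w , ≤-trans le (m≤n+m m 2)
  base-step (inj₂ (i , a)) (inj₂ (j , b)) e w le with refl ← eqᵇ⇒≡ (∧-conicalˡ (eqᵇ i j) (adj H a b) e) =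
    _ , w , m≤n⇒m≤1+n le

  base-walk : ∀ {x y m} → Walk (corona G H) x y m →
              ∃[ k ] (Walk G (base (decode G H x)) (base (decode G H y)) k ×
                      depth (decode G H y) + k ≤ depth (decode G H x) + m)
  base-walk here = 0 , here , ≤-refl
  base-walk (step e p) with base-walk p
  ... | k , p′ , le = base-step _ _ e p′ le

  Dist-ι-copy : ∀ {w i k x a} → Dist G w i k → decode G H x ≡ inj₂ (i , a) →
                Dist (corona G H) (ι w) x (suc k)
  Dist-ι-copy {w} {i} {k} {x} (walk , shortest) dx =
    Walk-snoc (Walk-map ι adj-ι walk) (adj-ι-copy dx) , shortest′
    where
    shortest′ : ∀ m → Walk (corona G H) (ι w) x m → suc k ≤ m
    shortest′ m p with base-walk p
    ... | k′ , p′ , le rewrite decode-ι w | dx = ≤-trans (s≤s (shortest k′ p′)) le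

  coronaEqualizer : Subset (n G) → Subset (n (corona G H))
  coronaEqualizer S = ⊤ ++ inflate (n H) S

  ∣coronaEqualizer∣ : ∀ S → ∣ coronaEqualizer S ∣ ≡ ∣ S ∣ * n H + n G
  ∣coronaEqualizer∣ S = begin
    ∣ ⊤ {n G} ++ inflate (n H) S ∣     ≡⟨ ∣p++q∣≡∣p∣+∣q∣ (⊤ {n G}) (inflate (n H) S) ⟩
    ∣ ⊤ {n G} ∣ + ∣ inflate (n H) S ∣  ≡⟨ cong₂ _+_ (∣⊤∣≡n (n G)) (∣inflate∣ (n H) S) ⟩
    n G + ∣ S ∣ * n H                  ≡⟨ +-comm (n G) _ ⟩
    ∣ S ∣ * n H + n G                  ∎
    where open ≡-Reasoning

  selected : Subset (n G) → CVertex G H → Bool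
  selected S (inj₁ _)       = true
  selected S (inj₂ (i , _)) = lookup S i

  lookup-coronaEqualizer : ∀ S x → lookup (coronaEqualizer S) x ≡ selected S (decode G H x)
  lookup-coronaEqualizer S x =
    trans (lookup-splitAt (n G) ⊤ (inflate (n H) S) x) (onBlocks (splitAt (n G) x))
    where
    onBlocks : ∀ s → [ lookup ⊤ , lookup (inflate (n H) S) ]′ s ≡
                     selected S (Sum.map₂ (remQuot {n G} (n H)) s)
    onBlocks (inj₁ i) = lookup-replicate i inside
    onBlocks (inj₂ j) = lookup-inflate (n H) S j

  selected⇒∈ : ∀ {S} x → selected S (decode G H x) ≡ true → x ∈ coronaEqualizer S
  selected⇒∈ {S} x sel = lookup⇒[]= x _ (trans (lookup-coronaEqualizer S x) sel)

  ι∈coronaEqualizer : ∀ {S} i → ι i ∈ coronaEqualizer S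
  ι∈coronaEqualizer {S} i = selected⇒∈ (ι i) (cong (selected S) (decode-ι i))

  ∉coronaEqualizer : ∀ {S} x → x ∉ coronaEqualizer S →
                     ∃[ i ] ∃[ a ] (decode G H x ≡ inj₂ (i , a) × i ∉ S)
  ∉coronaEqualizer {S} x x∉ with decode G H x in dx
  ... | inj₁ i       = ⊥-elim (x∉ (selected⇒∈ x (cong (selected S) dx)))
  ... | inj₂ (i , a) =
    i , a , refl , λ i∈S → x∉ (selected⇒∈ x (trans (cong (selected S) dx) ([]=⇒lookup i∈S)))

  coronaEqualizer-isDistanceEqualizer : ∀ {S} → IsDistanceEqualizer G S →
                                        IsDistanceEqualizer (corona G H) (coronaEqualizer S)
  coronaEqualizer-isDistanceEqualizer {S} equalizes x y _ x∉ y∉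
    with ∉coronaEqualizer x x∉ | ∉coronaEqualizer y y∉
  ... | i , a , dx , i∉S | j , b , dy , j∉S with i ≟ j
  ... | yes refl = ι i , ι∈coronaEqualizer {S} i , 1 ,
                   Dist-ι-copy (Dist-refl i) dx , Dist-ι-copy (Dist-refl i) dy
  ... | no i≢j with equalizes i j i≢j i∉S j∉S
  ... | w , _ , k , dwi , dwj = ι w , ι∈coronaEqualizer {S} w , suc k ,
                                Dist-ι-copy dwi dx , Dist-ι-copy dwj dy

open Corona

proposition33 : (G H : Graph) → Connected G → (a b : ℕ) →
                IsXi G a → IsXi (corona G H) b →
                b ≤ a * order H + order G
proposition33 G H _ a b ((S , equalizes , refl) , _) (_ , minimal) =
  subst (b ≤_) (∣coronaEqualizer∣ G H S)
    (minimal (coronaEqualizer G H S) (coronaEqualizer-isDistanceEqualizer G H equalizes))
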